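{- Let $G$ be a graph with minimum degree $\delta(G)\ge2$. If $G$ contains no even cycle, then $G$ admits a $1$-sum $[0,1]$-flow.
   Context: For a graph $G=(V,E)$ and $L\subseteq\mathbb{R}$, a $1$-sum $L$-flow is a function $\omega:E\to L$ such that $\sum_{e\ni v}\omega(e)=1$ for every vertex $v$. -}

module Defs where

open import Data.Bool using (Bool; true; false; if_then_else_)
open import Data.Nat as ℕ using (ℕ; zero; suc; _≥_)
open import Data.Nat.Properties using ()
open import Data.Fin using (Fin; zero; suc; toℕ)
open import Data.Product using (Σ; ∃; _×_; _,_)
open import Data.Rational as ℚ using (ℚ; 0ℚ; 1ℚ)
open import Data.Nat using (_%_; _<_)
open import Relation.Binary.PropositionalEquality using (_≡_; _≢_)
open import Relation.Nullary using (¬_)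
open import Function.Definitions using (Injective)

record Graph (n : ℕ) : Set where
  field
    adj   : Fin n → Fin n → Bool
    sym   : ∀ u v → adj u v ≡ adj v u
    irrefl : ∀ v → adj v v ≡ false

open Graph public

Edge : ∀ {n} → Graph n → Fin n → Fin n → Set
Edge G u v = adj G u v ≡ true

sumℕ : ∀ {n} → (Fin n → ℕ) → ℕ
sumℕ {zero}  f = 0
sumℕ {suc n} f = f zero ℕ.+ sumℕ (λ i → f (suc i))

sumℚ : ∀ {n} → (Fin n → ℚ) → ℚ
sumℚ {zero}  f = 0ℚ
sumℚ {suc n} f = f zero ℚ.+ sumℚ (λ i → f (suc i))

degree : ∀ {n} → Graph n → Fin n → ℕ
degree G v = sumℕ (λ u → if adj G v u then 1 else 0)

MinDegree≥ : ∀ {n} → Graph n → ℕ → Set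
MinDegree≥ G k = ∀ v → degree G v ≥ k

next : ∀ {k} → Fin k → Fin k
next {suc k} i = Data.Fin.fromℕ< (Data.Nat.DivMod.m%n<n (suc (toℕ i)) (suc k))
  where import Data.Nat.DivMod

record Cycle {n} (G : Graph n) (k : ℕ) : Set where
  field
    len≥3   : k ≥ 3
    vertex  : Fin k → Fin n
    distinct : Injective _≡_ _≡_ vertex
    consec  : ∀ i → Edge G (vertex i) (vertex (next i))

Even : ℕ → Set
Even k = k % 2 ≡ 0

HasEvenCycle : ∀ {n} → Graph n → Set
HasEvenCycle G = Σ ℕ (λ k → Even k × Cycle G k)

-- A 1-sum flow with values in L (a predicate on ℚ): ω assigns a value to
-- each edge (ω u v = ω v u, so ω is a function of the unordered edge),
-- values on edges lie in L, and the sum over edges at each vertex is 1.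
record OneSumFlow {n} (G : Graph n) (L : ℚ → Set) : Set where
  field
    ω        : Fin n → Fin n → ℚ
    ω-sym    : ∀ u v → Edge G u v → ω u v ≡ ω v u
    ω-in-L   : ∀ u v → Edge G u v → L (ω u v)
    ω-sum    : ∀ v → sumℚ (λ u → if adj G v u then ω v u else 0ℚ) ≡ 1ℚ

UnitInterval : ℚ → Set
UnitInterval x = (0ℚ ℚ.≤ x) × (x ℚ.≤ 1ℚ)

-- The first vertex of a maximal path in a graph without even cycles and without vertices of
-- degree one has degree two: three neighbours on the path would close three cycles of lengths
-- 3 + i, 3 + j and 4 + i + j.  Near such a vertex the graph can be reduced: either a path a v b
-- through a vertex v of degree two is contracted to one vertex, or a triangle is deleted.  Both
-- keep the hypotheses and shrink the set of non-isolated vertices, so by induction there is a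
-- permutation of the vertices sending each non-isolated vertex to a neighbour, i.e. a spanning
-- union of edges and cycles; it lifts back through each reduction.  Weight ½ along each step of
-- the permutation is then a 1-sum flow with values in {0, ½, 1}.

module Submission where

open import Defs hiding (sym)
open import Algebra.Bundles using (CommutativeMonoid)
import Algebra.Properties.CommutativeSemigroup as CommutativeSemigroupProperties
open import Data.Bool using (Bool; true; false; if_then_else_)
import Data.Bool.Properties as Bool
open import Data.Empty using (⊥; ⊥-elim)
open import Data.Fin using (Fin; zero; suc; toℕ)
open import Data.Fin.Permutation using (Permutation′; _⟨$⟩ʳ_; _⟨$⟩ˡ_; inverseˡ; inverseʳ; flip; transpose; _∘ₚ_)
import Data.Fin.Permutation as Permutation
open import Data.Fin.Properties using (_≟_; any?; toℕ-fromℕ<; toℕ<n; injective⇒≤)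
open import Data.List using (List; []; _∷_; _++_; [_]; length; lookup; filter; allFin)
open import Data.List.Properties using (++-assoc; ++-identityʳ; length-++; length-++-comm; length-tabulate; filter-notAll)
open import Data.List.Membership.Propositional using (_∈_; _∉_)
open import Data.List.Membership.Propositional.Properties using (∈-lookup; ∈-∃++; ∈-filter⁺; ∈-allFin)
open import Data.List.Relation.Binary.Disjoint.Propositional using (Disjoint)
open import Data.List.Relation.Unary.All as All using (All; []; _∷_)
import Data.List.Membership.DecPropositional as DecMembership
import Data.List.Relation.Unary.All.Properties as All
open import Data.List.Relation.Unary.All.Properties.Core using (¬Any⇒All¬)
open import Data.List.Relation.Unary.AllPairs using ([]; _∷_)
open import Data.List.Relation.Unary.Any as Any using (here; there)
open import Data.List.Relation.Unary.Linked as Linked using (Linked; []; [-]; _∷_)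
open import Data.List.Relation.Unary.Unique.Propositional using (Unique)
import Data.List.Relation.Unary.Unique.Propositional.Properties as Unique
open import Data.Nat using (ℕ; zero; suc; _+_; _%_; _≤_; _<_; z≤n; s≤s)
import Data.Nat.Properties as ℕ
open import Data.Nat.DivMod using (m<n⇒m%n≡m; n%n≡0; m%n<n)
open import Data.Rational as ℚ using (ℚ; 0ℚ; 1ℚ; ½)
import Data.Rational.Properties as ℚ
open import Data.Product using (∃; ∃-syntax; _×_; _,_; proj₁; proj₂)
open import Data.Sum as Sum using (_⊎_; inj₁; inj₂)
open import Data.Unit using (⊤)
open import Function.Base using (_∘_)
open import Function.Bundles using (mk⇔)
open import Relation.Binary.PropositionalEquality hiding ([_])
open import Relation.Nullary using (¬_; ¬?; Dec; yes; no; does)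
open import Relation.Nullary.Decidable using (dec-true; dec-false; does-⇔; from-yes; map′; _×-dec_; _⊎-dec_)

variable
  n : ℕ
  A : Set

infix 4 _∈?_
_∈?_ : (x : Fin n) (xs : List (Fin n)) → Dec (x ∈ xs)
_∈?_ = DecMembership._∈?_ _≟_

Isolated : Graph n → Fin n → Set
Isolated G y = ∀ z → ¬ Edge G y z

NonIsolated : Graph n → Fin n → Set
NonIsolated G y = ∃ (Edge G y)

NoPendant : Graph n → Set
NoPendant G = ∀ y z → Edge G y z → ∃[ w ] w ≢ z × Edge G y w

TwoNeighbours : Graph n → Fin n → Set
TwoNeighbours G y = ∃[ w₁ ] ∃[ w₂ ] w₁ ≢ w₂ × Edge G y w₁ × Edge G y w₂

another-neighbour : ∀ {G : Graph n} {y} → TwoNeighbours G y → ∀ z → ∃[ w ] w ≢ z × Edge G y w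
another-neighbour (w₁ , w₂ , w₁≢w₂ , e₁ , e₂) z with w₁ ≟ z
... | yes refl = w₂ , ≢-sym w₁≢w₂ , e₂
... | no w₁≢z  = w₁ , w₁≢z , e₁

module _ (G : Graph n) where

  Edge-sym : ∀ {u w} → Edge G u w → Edge G w u
  Edge-sym {u} {w} e = trans (Graph.sym G w u) e

  Edge⇒≢ : ∀ {u w} → Edge G u w → u ≢ w
  Edge⇒≢ {u} e refl with () ← trans (sym e) (Graph.irrefl G u)

  Edge? : ∀ u w → Dec (Edge G u w)
  Edge? u w = adj G u w Bool.≟ true

module FromRelation {R : Fin n → Fin n → Set} (R? : ∀ y z → Dec (R y z))
                    (R-sym : ∀ {y z} → R y z → R z y) (R-irrefl : ∀ {y} → ¬ R y y) where

  opaque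
    graph : Graph n
    graph = record
      { adj    = λ y z → does (R? y z)
      ; sym    = λ y z → does-⇔ (mk⇔ R-sym R-sym) (R? y z) (R? z y)
      ; irrefl = λ y → dec-false (R? y y) R-irrefl
      }

    Edge⇒R : ∀ y z → Edge graph y z → R y z
    Edge⇒R y z e with R? y z | e
    ... | yes r | _ = r

    R⇒Edge : ∀ {y z} → R y z → Edge graph y z
    R⇒Edge {y} {z} = dec-true (R? y z)

module _ {R : A → A → Set} where

  linked-split : ∀ xs {y zs} → Linked R (xs ++ y ∷ zs) → Linked R (xs ++ [ y ]) × Linked R (y ∷ zs)
  linked-split []           l       = [-] , l
  linked-split (x ∷ [])     (r ∷ l) = r ∷ [-] , l
  linked-split (x ∷ x′ ∷ xs) (r ∷ l) with linked-split (x′ ∷ xs) l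
  ... | l₁ , l₂ = r ∷ l₁ , l₂

  linked-join : ∀ xs {y zs} → Linked R (xs ++ [ y ]) → Linked R (y ∷ zs) → Linked R (xs ++ y ∷ zs)
  linked-join []            _        l₂ = l₂
  linked-join (x ∷ [])      (r ∷ _)  l₂ = r ∷ l₂
  linked-join (x ∷ x′ ∷ xs) (r ∷ l₁) l₂ = r ∷ linked-join (x′ ∷ xs) l₁ l₂

  linked-map : ∀ {S : A → A → Set} {P : A → Set} → (∀ {x y} → P x → P y → R x y → S x y) →
               ∀ {xs} → All P xs → Linked R xs → Linked S xs
  linked-map f _                []      = []
  linked-map f _                [-]     = [-]
  linked-map f (px ∷ py ∷ pxs) (r ∷ l) = f px py r ∷ linked-map f (py ∷ pxs) l

linked-sources : ∀ {R : A → A → Set} xs {e} → Linked R (xs ++ [ e ]) → All (λ x → ∃ (R x)) xs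
linked-sources []            _       = []
linked-sources (x ∷ [])      (r ∷ _) = (_ , r) ∷ []
linked-sources (x ∷ x′ ∷ xs) (r ∷ l) = (_ , r) ∷ linked-sources (x′ ∷ xs) l

CyclicallyLinked : (A → A → Set) → List A → Set
CyclicallyLinked R []       = ⊤
CyclicallyLinked R (x ∷ xs) = Linked R (x ∷ xs ++ [ x ])

module _ {R : A → A → Set} where

  cyclicallyLinked-close : ∀ x xs {y} → Linked R (x ∷ xs ++ [ y ]) → R y x →
                           CyclicallyLinked R (x ∷ xs ++ [ y ])
  cyclicallyLinked-close x xs {y} l r =
    subst (λ ys → Linked R (x ∷ ys)) (sym (++-assoc xs [ y ] [ x ])) (linked-join (x ∷ xs) l (r ∷ [-]))

  cyclicallyLinked-rotate : ∀ xs ys → CyclicallyLinked R (xs ++ ys) → CyclicallyLinked R (ys ++ xs)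
  cyclicallyLinked-rotate [] ys l = subst (CyclicallyLinked R) (sym (++-identityʳ ys)) l
  cyclicallyLinked-rotate (x ∷ xs) ys l =
    subst (CyclicallyLinked R) (++-assoc ys [ x ] xs)
      (cyclicallyLinked-rotate xs (ys ++ [ x ]) (subst (CyclicallyLinked R) (++-assoc xs ys [ x ]) (rotate₁ (xs ++ ys) l)))
    where
    rotate₁ : ∀ zs → CyclicallyLinked R (x ∷ zs) → CyclicallyLinked R (zs ++ [ x ])
    rotate₁ []       l       = l
    rotate₁ (z ∷ zs) (r ∷ l) = cyclicallyLinked-close z zs l r

unique-split : ∀ (xs : List A) {ys} → Unique (xs ++ ys) → Unique xs × Unique ys × Disjoint xs ys
unique-split []       u        = [] , u , λ ()
unique-split (x ∷ xs) (px ∷ u) with unique-split xs u | All.++⁻ xs px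
... | uxs , uys , disjoint | pxs , pys =
  pxs ∷ uxs , uys , λ { (here refl , m) → All.lookup pys m refl ; (there m , m′) → disjoint (m , m′) }

unique-swap : ∀ (xs : List A) {ys} → Unique (xs ++ ys) → Unique (ys ++ xs)
unique-swap xs u with unique-split xs u
... | uxs , uys , disjoint = Unique.++⁺ uys uxs λ (m , m′) → disjoint (m′ , m)

lookup-injective : ∀ {xs : List A} → Unique xs → ∀ {i j} → lookup xs i ≡ lookup xs j → i ≡ j
lookup-injective (_  ∷ _) {zero}  {zero}  _ = refl
lookup-injective (px ∷ _) {zero}  {suc j} e = ⊥-elim (All.lookup px (∈-lookup j) e)
lookup-injective (px ∷ _) {suc i} {zero}  e = ⊥-elim (All.lookup px (∈-lookup i) (sym e))
lookup-injective (_  ∷ u) {suc i} {suc j} e = cong suc (lookup-injective u e)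

unique-length≤ : ∀ {xs : List (Fin n)} → Unique xs → length xs ≤ n
unique-length≤ u = injective⇒≤ (lookup-injective u)

-- Cycles as vertex lists

record CycleList (G : Graph n) : Set where
  field
    vertices : List (Fin n)
    unique   : Unique vertices
    long     : 3 ≤ length vertices
    closed   : CyclicallyLinked (Edge G) vertices

open CycleList using (vertices)

OddCycles : Graph n → Set
OddCycles G = (C : CycleList G) → ¬ Even (length (vertices C))

-- The entry at position m, or d past the end: this lets the closing edge of a cycle be read off uniformly.
at : List A → A → ℕ → A
at []       d _       = d
at (x ∷ xs) d zero    = x
at (x ∷ xs) d (suc m) = at xs d m

lookup≡at : ∀ (xs : List A) d i → lookup xs i ≡ at xs d (toℕ i)
lookup≡at (x ∷ xs) d zero    = refl
lookup≡at (x ∷ xs) d (suc i) = lookup≡at xs d i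

at-length : ∀ (xs : List A) d → at xs d (length xs) ≡ d
at-length []       d = refl
at-length (x ∷ xs) d = at-length xs d

linked-at : ∀ {R : A → A → Set} xs {d} → Linked R (xs ++ [ d ]) → ∀ i → R (lookup xs i) (at xs d (suc (toℕ i)))
linked-at (x ∷ [])     (r ∷ _) zero    = r
linked-at (x ∷ x′ ∷ xs) (r ∷ _) zero    = r
linked-at (x ∷ x′ ∷ xs) (_ ∷ l) (suc i) = linked-at (x′ ∷ xs) l i

toℕ-next : ∀ {k} (i : Fin (suc k)) → toℕ (next i) ≡ suc (toℕ i) % suc k
toℕ-next {k} i = toℕ-fromℕ< (m%n<n (suc (toℕ i)) (suc k))

at-next : ∀ (xs : List A) (i : Fin (length xs)) {d} → at xs d 0 ≡ d →
          at xs d (toℕ (next i)) ≡ at xs d (suc (toℕ i))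
at-next xs@(_ ∷ _) i {d} at₀ with ℕ.m≤n⇒m<n∨m≡n (toℕ<n i)
... | inj₁ lt = cong (at xs d) (trans (toℕ-next i) (m<n⇒m%n≡m lt))
... | inj₂ eq = begin
  at xs d (toℕ (next i))            ≡⟨ cong (at xs d) (toℕ-next i) ⟩
  at xs d (suc (toℕ i) % length xs) ≡⟨ cong (λ m → at xs d (m % length xs)) eq ⟩
  at xs d (length xs % length xs)   ≡⟨ cong (at xs d) (n%n≡0 (length xs)) ⟩
  at xs d 0                         ≡⟨ trans at₀ (sym (at-length xs d)) ⟩
  at xs d (length xs)               ≡⟨ cong (at xs d) (sym eq) ⟩
  at xs d (suc (toℕ i))             ∎
  where open ≡-Reasoning

module _ {G : Graph n} where

  toCycle : (C : CycleList G) → Cycle G (length (vertices C))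
  toCycle record { vertices = x ∷ xs ; unique = u ; long = l ; closed = c } = record
    { len≥3    = l
    ; vertex   = lookup (x ∷ xs)
    ; distinct = lookup-injective u
    ; consec   = λ i → subst (Edge G (lookup (x ∷ xs) i))
                   (sym (trans (lookup≡at (x ∷ xs) x (next i)) (at-next (x ∷ xs) i refl)))
                   (linked-at (x ∷ xs) c i)
    }

  ¬HasEvenCycle⇒OddCycles : ¬ HasEvenCycle G → OddCycles G
  ¬HasEvenCycle⇒OddCycles ¬even C even = ¬even (length (vertices C) , even , toCycle C)

-- A vertex of degree two

length-snoc : ∀ (xs : List A) x → length (xs ++ [ x ]) ≡ suc (length xs)
length-snoc xs x = trans (length-++ xs) (ℕ.+-comm (length xs) 1)

-- Three cycles whose lengths are 3 + a, 3 + b and 4 + a + b cannot all be odd.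
even-or : ∀ a b → Even (suc a) ⊎ Even (suc b) ⊎ Even (a + b)
even-or (suc zero)    b             = inj₁ refl
even-or (suc (suc a)) b             = even-or a b
even-or zero          zero          = inj₂ (inj₂ refl)
even-or zero          (suc zero)    = inj₂ (inj₁ refl)
even-or zero          (suc (suc b)) = even-or zero b

ordered : ∀ {c d : A} ys → c ∈ ys → d ∈ ys → c ≢ d →
          ∃[ P ] ∃[ Q ] ∃[ R ] (ys ≡ P ++ c ∷ Q ++ d ∷ R ⊎ ys ≡ P ++ d ∷ Q ++ c ∷ R)
ordered (y ∷ ys) (here refl) (here refl) c≢d = ⊥-elim (c≢d refl)
ordered (y ∷ ys) (here refl) (there d∈) _ with Q , R , refl ← ∈-∃++ d∈ = [] , Q , R , inj₁ refl
ordered (y ∷ ys) (there c∈) (here refl) _ with Q , R , refl ← ∈-∃++ c∈ = [] , Q , R , inj₂ refl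
ordered (y ∷ ys) (there c∈) (there d∈) c≢d with ordered ys c∈ d∈ c≢d
... | P , Q , R , inj₁ refl = y ∷ P , Q , R , inj₁ refl
... | P , Q , R , inj₂ refl = y ∷ P , Q , R , inj₂ refl

record OnlyNeighbours (G : Graph n) (v a b : Fin n) : Set where
  field
    distinct : a ≢ b
    edgeᵃ    : Edge G v a
    edgeᵇ    : Edge G v b
    only     : ∀ u → Edge G v u → u ≡ a ⊎ u ≡ b

record MaximalPath (G : Graph n) : Set where
  field
    start   : Fin n
    rest    : List (Fin n)
    unique  : Unique (start ∷ rest)
    linked  : Linked (Edge G) (start ∷ rest)
    active  : NonIsolated G start
    maximal : ∀ z → Edge G start z → z ∈ rest

module _ {G : Graph n} where

  maximalPath : ∀ {y z} → Edge G y z → MaximalPath G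
  maximalPath {y} {z} e = extend n y [] (ℕ.m≤m+n n 1) ([] ∷ []) [-] (z , e)
    where
    extend : ∀ fuel x ps → n ≤ fuel + length (x ∷ ps) → Unique (x ∷ ps) → Linked (Edge G) (x ∷ ps) →
             NonIsolated G x → MaximalPath G
    extend fuel x ps bound u l act with any? (λ z → Edge? G x z ×-dec ¬? (z ∈? x ∷ ps))
    ... | no ¬extension = record
      { start = x ; rest = ps ; unique = u ; linked = l ; active = act ; maximal = maximal }
      where
      maximal : ∀ z → Edge G x z → z ∈ ps
      maximal z e with z ∈? x ∷ ps
      ... | yes (here refl) = ⊥-elim (Edge⇒≢ G e refl)
      ... | yes (there z∈)  = z∈
      ... | no  z∉          = ⊥-elim (¬extension (z , e , z∉))
    ... | yes (z , e , z∉) with fuel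
    ...   | zero  = ⊥-elim (ℕ.<⇒≱ (s≤s bound) (unique-length≤ (¬Any⇒All¬ _ z∉ ∷ u)))
    ...   | suc f = extend f z (x ∷ ps) (ℕ.≤-trans bound (ℕ.≤-reflexive (sym (ℕ.+-suc f _))))
                      (¬Any⇒All¬ _ z∉ ∷ u) (Edge-sym G e ∷ l) (x , Edge-sym G e)

  module _ (odd : OddCycles G) where

    ¬chord : ∀ x y zs w rest → Unique (x ∷ y ∷ zs ++ w ∷ rest) → Linked (Edge G) (x ∷ y ∷ zs ++ w ∷ rest) →
             Edge G x w → ¬ Even (suc (length zs))
    ¬chord x y zs w rest u l xw = odd C ∘ subst Even (cong (2 +_) (sym (length-snoc zs w)))
      where
      C : CycleList G
      C = record
        { vertices = x ∷ y ∷ zs ++ [ w ]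
        ; unique   = proj₁ (unique-split (x ∷ y ∷ zs ++ [ w ])
                       (subst Unique (cong (λ t → x ∷ y ∷ t) (sym (++-assoc zs [ w ] rest))) u))
        ; long     = subst (3 ≤_) (cong (2 +_) (sym (length-snoc zs w))) (s≤s (s≤s (s≤s z≤n)))
        ; closed   = cyclicallyLinked-close x (y ∷ zs) (proj₁ (linked-split (x ∷ y ∷ zs) l)) (Edge-sym G xw)
        }

    -- The chords xc and xd close the cycles x…c, x…c…d and x c…d.
    ¬two-chords : ∀ x y A c B d R → Unique (x ∷ y ∷ A ++ c ∷ B ++ d ∷ R) →
                  Linked (Edge G) (x ∷ y ∷ A ++ c ∷ B ++ d ∷ R) → Edge G x c → Edge G x d → ⊥
    ¬two-chords x y A c B d R u@(x∉ ∷ u′) l xc xd with even-or (length A) (length B)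
    ... | inj₁ even        = ¬chord x y A c (B ++ d ∷ R) u l xc even
    ... | inj₂ (inj₁ even) = ¬chord x c B d R (All.++⁻ʳ (y ∷ A) x∉ ∷ proj₁ (proj₂ (unique-split (y ∷ A) u′)))
                               (xc ∷ proj₂ (linked-split (x ∷ y ∷ A) l)) xd even
    ... | inj₂ (inj₂ even) = ¬chord x y (A ++ c ∷ B) d R (subst Unique W≡ u) (subst (Linked (Edge G)) W≡ l) xd
                               (subst Even (cong suc (sym (trans (length-++ A) (ℕ.+-suc (length A) (length B))))) even)
      where
      W≡ : x ∷ y ∷ A ++ c ∷ B ++ d ∷ R ≡ x ∷ y ∷ (A ++ c ∷ B) ++ d ∷ R
      W≡ = cong (λ t → x ∷ y ∷ t) (sym (++-assoc A (c ∷ B) (d ∷ R)))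

    ¬two-chords-beyond : ∀ x y ys {c d} → Unique (x ∷ y ∷ ys) → Linked (Edge G) (x ∷ y ∷ ys) →
                         c ≢ d → c ∈ ys → d ∈ ys → Edge G x c → Edge G x d → ⊥
    ¬two-chords-beyond x y ys u l c≢d c∈ d∈ xc xd with ordered ys c∈ d∈ c≢d
    ... | P , Q , R , inj₁ refl = ¬two-chords x y P _ Q _ R u l xc xd
    ... | P , Q , R , inj₂ refl = ¬two-chords x y P _ Q _ R u l xd xc

    ¬three-chords : ∀ x ps {a b c} → Unique (x ∷ ps) → Linked (Edge G) (x ∷ ps) → a ≢ b → a ≢ c → b ≢ c →
                    a ∈ ps → b ∈ ps → c ∈ ps → Edge G x a → Edge G x b → Edge G x c → ⊥
    ¬three-chords x (y ∷ ys) {a} {b} u l a≢b a≢c b≢c a∈ b∈ c∈ xa xb xc with a ≟ y | b ≟ y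
    ... | yes refl | _        = ¬two-chords-beyond x y ys u l b≢c (Any.tail (≢-sym a≢b) b∈) (Any.tail (≢-sym a≢c) c∈) xb xc
    ... | no a≢y   | yes refl = ¬two-chords-beyond x y ys u l a≢c (Any.tail a≢y a∈) (Any.tail (≢-sym b≢c) c∈) xa xc
    ... | no a≢y   | no b≢y   = ¬two-chords-beyond x y ys u l a≢b (Any.tail a≢y a∈) (Any.tail b≢y b∈) xa xb

    -- The first vertex of a maximal path has all its neighbours on the path, so at most two of them.
    onlyNeighbours : NoPendant G → ∀ {y z} → Edge G y z → ∃[ v ] ∃[ a ] ∃[ b ] OnlyNeighbours G v a b
    onlyNeighbours noPendant e with maximalPath e
    ... | record { start = x ; rest = ps ; unique = u ; linked = l ; active = (a , xa) ; maximal = maximal }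
        with noPendant x a xa
    ...   | b , b≢a , xb = x , a , b , record { distinct = ≢-sym b≢a ; edgeᵃ = xa ; edgeᵇ = xb ; only = only }
      where
      only : ∀ c → Edge G x c → c ≡ a ⊎ c ≡ b
      only c xc with c ≟ a | c ≟ b
      ... | yes c≡a | _       = inj₁ c≡a
      ... | no _    | yes c≡b = inj₂ c≡b
      ... | no c≢a  | no c≢b  = ⊥-elim (¬three-chords x ps u l (≢-sym b≢a) (≢-sym c≢a) (≢-sym c≢b)
                                   (maximal a xa) (maximal b xb) (maximal c xc) xa xb xc)

-- Permutations along edges, and the flow

transpose-matchˡ : ∀ (i j : Fin n) → transpose i j ⟨$⟩ʳ i ≡ j
transpose-matchˡ i j rewrite dec-true (i ≟ i) refl = refl

transpose-matchʳ : ∀ (i j : Fin n) → transpose i j ⟨$⟩ʳ j ≡ i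
transpose-matchʳ i j with j ≟ i
... | yes refl = refl
... | no j≢i rewrite dec-true (j ≟ j) refl = refl

transpose-fix : ∀ {i j k : Fin n} → k ≢ i → k ≢ j → transpose i j ⟨$⟩ʳ k ≡ k
transpose-fix {i = i} {j} {k} k≢i k≢j rewrite dec-false (k ≟ i) k≢i | dec-false (k ≟ j) k≢j = refl

permutation-injective : ∀ (π : Permutation′ n) {y z} → π ⟨$⟩ʳ y ≡ π ⟨$⟩ʳ z → y ≡ z
permutation-injective π eq = trans (sym (inverseˡ π)) (trans (cong (π ⟨$⟩ˡ_) eq) (inverseˡ π))

record NeighbourPermutation (G : Graph n) : Set where
  field
    π        : Permutation′ n
    adjacent : ∀ y → NonIsolated G y → Edge G y (π ⟨$⟩ʳ y)
    fixed    : ∀ y → Isolated G y → π ⟨$⟩ʳ y ≡ y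

module _ {G : Graph n} where

  nonIsolated? : ∀ y → Dec (NonIsolated G y)
  nonIsolated? y = any? (Edge? G y)

  identityPermutation : (∀ y → Isolated G y) → NeighbourPermutation G
  identityPermutation isolated = record
    { π        = Permutation.id
    ; adjacent = λ { y (z , e) → ⊥-elim (isolated y z e) }
    ; fixed    = λ _ _ → refl
    }

  reverse : NeighbourPermutation G → NeighbourPermutation G
  reverse P = record { π = flip π ; adjacent = adjacent′ ; fixed = fixed′ }
    where
    open NeighbourPermutation P

    adjacent′ : ∀ y → NonIsolated G y → Edge G y (π ⟨$⟩ˡ y)
    adjacent′ y (z , e) with nonIsolated? (π ⟨$⟩ˡ y)
    ... | yes active = Edge-sym G (subst (Edge G _) (inverseʳ π) (adjacent _ active))
    ... | no  idle   = ⊥-elim (idle (z , subst (λ w → Edge G w z) y≡π⁻¹y e))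
      where
      y≡π⁻¹y : y ≡ π ⟨$⟩ˡ y
      y≡π⁻¹y = trans (sym (inverseʳ π)) (fixed _ (λ w e′ → idle (w , e′)))

    fixed′ : ∀ y → Isolated G y → π ⟨$⟩ˡ y ≡ y
    fixed′ y isolated = trans (cong (π ⟨$⟩ˡ_) (sym (fixed y isolated))) (inverseˡ π)

½-if : Bool → ℚ
½-if b = if b then ½ else 0ℚ

sumℚ-cong : ∀ {f g : Fin n → ℚ} → (∀ i → f i ≡ g i) → sumℚ f ≡ sumℚ g
sumℚ-cong {zero}  e = refl
sumℚ-cong {suc n} e = cong₂ ℚ._+_ (e zero) (sumℚ-cong (λ i → e (suc i)))

sumℚ-+ : ∀ (f g : Fin n → ℚ) → sumℚ (λ i → f i ℚ.+ g i) ≡ sumℚ f ℚ.+ sumℚ g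
sumℚ-+ {zero}  f g = refl
sumℚ-+ {suc n} f g = trans (cong (f zero ℚ.+ g zero ℚ.+_) (sumℚ-+ (λ i → f (suc i)) (λ i → g (suc i))))
                           (interchange (f zero) (g zero) _ _)
  where open CommutativeSemigroupProperties (CommutativeMonoid.commutativeSemigroup ℚ.+-0-commutativeMonoid)

sumℚ-0 : sumℚ {n} (λ _ → 0ℚ) ≡ 0ℚ
sumℚ-0 {zero}  = refl
sumℚ-0 {suc n} = cong (0ℚ ℚ.+_) (sumℚ-0 {n})

sumℚ-½-if-≟ : ∀ (p : Fin n) → sumℚ (λ u → ½-if (does (p ≟ u))) ≡ ½
sumℚ-½-if-≟ {suc n} zero    = trans (cong (½ ℚ.+_) (sumℚ-0 {n})) (ℚ.+-identityʳ ½)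
sumℚ-½-if-≟ {suc n} (suc p) = trans (cong (0ℚ ℚ.+_) (trans (sumℚ-cong suc≟suc) (sumℚ-½-if-≟ p))) (ℚ.+-identityˡ ½)
  where
  suc≟suc : ∀ u → ½-if (does (suc p ≟ suc u)) ≡ ½-if (does (p ≟ u))
  suc≟suc u with p ≟ u
  ... | yes _ = refl
  ... | no  _ = refl

½-if+½-if∈[0,1] : ∀ b c → UnitInterval (½-if b ℚ.+ ½-if c)
½-if+½-if∈[0,1] true  true  = from-yes (0ℚ ℚ.≤? 1ℚ) , from-yes (1ℚ ℚ.≤? 1ℚ)
½-if+½-if∈[0,1] true  false = from-yes (0ℚ ℚ.≤? ½) , from-yes (½ ℚ.≤? 1ℚ)
½-if+½-if∈[0,1] false true  = from-yes (0ℚ ℚ.≤? ½) , from-yes (½ ℚ.≤? 1ℚ)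
½-if+½-if∈[0,1] false false = from-yes (0ℚ ℚ.≤? 0ℚ) , from-yes (0ℚ ℚ.≤? 1ℚ)

module _ {G : Graph n} (active : ∀ y → NonIsolated G y) (P : NeighbourPermutation G) where
  open NeighbourPermutation P

  -- Weight ½ on every edge of the permutation's cycles, counted once per direction: a 2-cycle gets weight 1.
  weight : Fin n → Fin n → ℚ
  weight u w = ½-if (does (π ⟨$⟩ʳ u ≟ w)) ℚ.+ ½-if (does (π ⟨$⟩ˡ u ≟ w))

  weight-sym : ∀ u w → weight u w ≡ weight w u
  weight-sym u w = trans (cong₂ (λ b c → ½-if b ℚ.+ ½-if c) (forward≡backward u w) (sym (forward≡backward w u)))
                         (ℚ.+-comm (½-if (does (π ⟨$⟩ˡ w ≟ u))) (½-if (does (π ⟨$⟩ʳ w ≟ u))))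
    where
    forward≡backward : ∀ u w → does (π ⟨$⟩ʳ u ≟ w) ≡ does (π ⟨$⟩ˡ w ≟ u)
    forward≡backward u w =
      does-⇔ (mk⇔ (λ { refl → inverseˡ π }) (λ { refl → inverseʳ π })) (π ⟨$⟩ʳ u ≟ w) (π ⟨$⟩ˡ w ≟ u)

  weight-off-edges : ∀ v u → adj G v u ≡ false → weight v u ≡ 0ℚ
  weight-off-edges v u non-edge with π ⟨$⟩ʳ v ≟ u | π ⟨$⟩ˡ v ≟ u
  ... | yes refl | _        with () ← trans (sym (adjacent v (active v))) non-edge
  ... | no _     | yes refl with () ← trans (sym (NeighbourPermutation.adjacent (reverse P) v (active v))) non-edge
  ... | no _     | no _     = refl

  weight-sum : ∀ v → sumℚ (λ u → if adj G v u then weight v u else 0ℚ) ≡ 1ℚ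
  weight-sum v = begin
    sumℚ (λ u → if adj G v u then weight v u else 0ℚ) ≡⟨ sumℚ-cong restrict ⟩
    sumℚ (weight v)                                    ≡⟨ sumℚ-+ forward backward ⟩
    sumℚ forward ℚ.+ sumℚ backward                     ≡⟨ cong₂ ℚ._+_ (sumℚ-½-if-≟ (π ⟨$⟩ʳ v)) (sumℚ-½-if-≟ (π ⟨$⟩ˡ v)) ⟩
    ½ ℚ.+ ½                                            ∎
    where
    open ≡-Reasoning
    forward backward : Fin n → ℚ
    forward u  = ½-if (does (π ⟨$⟩ʳ v ≟ u))
    backward u = ½-if (does (π ⟨$⟩ˡ v ≟ u))
    restrict : ∀ u → (if adj G v u then weight v u else 0ℚ) ≡ weight v u
    restrict u with adj G v u in eq
    ... | true  = refl
    ... | false = sym (weight-off-edges v u eq)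

  neighbourPermutation⇒flow : OneSumFlow G UnitInterval
  neighbourPermutation⇒flow = record
    { ω      = weight
    ; ω-sym  = λ u w _ → weight-sym u w
    ; ω-in-L = λ u w _ → ½-if+½-if∈[0,1] (does (π ⟨$⟩ʳ u ≟ w)) (does (π ⟨$⟩ˡ u ≟ w))
    ; ω-sum  = weight-sum
    }

-- Reductions

-- One step of the induction: a graph with fewer non-isolated vertices whose permutations lift to G.
record Reduction (G : Graph n) : Set where
  field
    smaller        : Graph n
    odd            : OddCycles smaller
    noPendant      : NoPendant smaller
    removed        : Fin n
    removed-active : NonIsolated G removed
    shrinks        : ∀ {y z} → Edge smaller y z → y ≢ removed × NonIsolated G y
    lift           : NeighbourPermutation smaller → NeighbourPermutation G

module Deletion {G : Graph n} {Keep : Fin n → Set} (keep? : ∀ y → Dec (Keep y)) where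

  open FromRelation (λ y z → keep? y ×-dec keep? z ×-dec Edge? G y z)
                    (λ (ky , kz , e) → kz , ky , Edge-sym G e) (λ (_ , _ , e) → Edge⇒≢ G e refl) public
    renaming (graph to induced)

  induced-odd : OddCycles G → OddCycles induced
  induced-odd odd record { vertices = [] ; long = () }
  induced-odd odd record { vertices = x ∷ xs ; unique = u ; long = long ; closed = closed } = odd record
    { vertices = x ∷ xs
    ; unique   = u
    ; long     = long
    ; closed   = Linked.map (λ {y} {z} e → proj₂ (proj₂ (Edge⇒R y z e))) closed
    }

  induced-two-neighbours : ∀ {y w₁ w₂} → Keep y → w₁ ≢ w₂ → Keep w₁ → Keep w₂ → Edge G y w₁ → Edge G y w₂ →
                           TwoNeighbours induced y
  induced-two-neighbours ky w₁≢w₂ k₁ k₂ e₁ e₂ = _ , _ , w₁≢w₂ , R⇒Edge (ky , k₁ , e₁) , R⇒Edge (ky , k₂ , e₂)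

  induced-noPendant : (∀ {y z} → Keep y → Edge G y z → TwoNeighbours induced y) → NoPendant induced
  induced-noPendant two y z yz with Edge⇒R y z yz
  ... | ky , _ , e = another-neighbour {G = induced} (two ky e) z

  induced-lift : (ρ : Permutation′ n) → (∀ {y} → Keep y → ρ ⟨$⟩ʳ y ≡ y) → (∀ {y} → ¬ Keep y → Edge G y (ρ ⟨$⟩ʳ y)) →
                 (∀ {y z} → Keep y → Edge G y z → NonIsolated induced y) →
                 NeighbourPermutation induced → NeighbourPermutation G
  induced-lift ρ ρ-kept ρ-adjacent kept-active P′ = record { π = ρ ∘ₚ π′ ; adjacent = adjacent ; fixed = fixed }
    where
    open NeighbourPermutation P′ using () renaming (π to π′; adjacent to adjacent′; fixed to fixed′)

    unkept-isolated : ∀ {y} → ¬ Keep y → Isolated induced y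
    unkept-isolated ¬ky z yz = ¬ky (proj₁ (Edge⇒R _ z yz))

    ρ-unkept : ∀ {y} → ¬ Keep y → ¬ Keep (ρ ⟨$⟩ʳ y)
    ρ-unkept ¬ky kρy = ¬ky (subst Keep (permutation-injective ρ (ρ-kept kρy)) kρy)

    adjacent : ∀ y → NonIsolated G y → Edge G y (π′ ⟨$⟩ʳ (ρ ⟨$⟩ʳ y))
    adjacent y (z , yz) with keep? y
    ... | yes ky = subst (λ w → Edge G y (π′ ⟨$⟩ʳ w)) (sym (ρ-kept ky))
                     (proj₂ (proj₂ (Edge⇒R y _ (adjacent′ y (kept-active ky yz)))))
    ... | no ¬ky = subst (Edge G y) (sym (fixed′ _ (unkept-isolated (ρ-unkept ¬ky)))) (ρ-adjacent ¬ky)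

    fixed : ∀ y → Isolated G y → π′ ⟨$⟩ʳ (ρ ⟨$⟩ʳ y) ≡ y
    fixed y isolated with keep? y
    ... | yes ky = trans (cong (π′ ⟨$⟩ʳ_) (ρ-kept ky)) (fixed′ y λ z yz → isolated z (proj₂ (proj₂ (Edge⇒R y z yz))))
    ... | no ¬ky = ⊥-elim (isolated _ (ρ-adjacent ¬ky))

module OnlyNeighboursProperties {G : Graph n} {v a b} (N : OnlyNeighbours G v a b) where
  open OnlyNeighbours N public

  Fresh : Fin n → Set
  Fresh y = y ≢ a × y ≢ b × y ≢ v

  fresh? : ∀ y → Dec (Fresh y)
  fresh? y = ¬? (y ≟ a) ×-dec ¬? (y ≟ b) ×-dec ¬? (y ≟ v)

  v≢a : v ≢ a
  v≢a = Edge⇒≢ G edgeᵃ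

  v≢b : v ≢ b
  v≢b = Edge⇒≢ G edgeᵇ

  neighbour≢v : ∀ {u y} → u ≢ a → u ≢ b → Edge G u y → y ≢ v
  neighbour≢v u≢a u≢b uy refl with only _ (Edge-sym G uy)
  ... | inj₁ u≡a = u≢a u≡a
  ... | inj₂ u≡b = u≢b u≡b

  -- a y b v would be a 4-cycle.
  ¬common-neighbour : OddCycles G → ∀ {y} → Edge G a y → Edge G b y → y ≢ v → ⊥
  ¬common-neighbour odd {y} ay by y≢v = odd square refl
    where
    square : CycleList G
    square = record
      { vertices = a ∷ y ∷ b ∷ v ∷ []
      ; unique   = (Edge⇒≢ G ay ∷ distinct ∷ ≢-sym v≢a ∷ []) ∷ (≢-sym (Edge⇒≢ G by) ∷ y≢v ∷ [])
                   ∷ (≢-sym v≢b ∷ []) ∷ [] ∷ []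
      ; long     = s≤s (s≤s (s≤s z≤n))
      ; closed   = ay ∷ Edge-sym G by ∷ Edge-sym G edgeᵇ ∷ edgeᵃ ∷ [-]
      }

module Contraction {G : Graph n} {v a b} (N : OnlyNeighbours G v a b) where
  open OnlyNeighboursProperties N

  Kept : Fin n → Set
  Kept y = y ≢ v × y ≢ b

  -- Contract the path a v b to the single vertex a: v and b become isolated.
  Joined : Fin n → Fin n → Set
  Joined y z = Edge G y z ⊎ (y ≡ a × Edge G b z) ⊎ (z ≡ a × Edge G y b)

  record Merged (y z : Fin n) : Set where
    constructor merged
    field
      kept₁    : Kept y
      kept₂    : Kept z
      loopless : y ≢ z
      joined   : Joined y z

  merged? : ∀ y z → Dec (Merged y z)
  merged? y z = map′ (λ (k₁ , k₂ , l , j) → merged k₁ k₂ l j) (λ (merged k₁ k₂ l j) → k₁ , k₂ , l , j)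
    (kept? y ×-dec kept? z ×-dec ¬? (y ≟ z) ×-dec
      (Edge? G y z ⊎-dec ((y ≟ a ×-dec Edge? G b z) ⊎-dec (z ≟ a ×-dec Edge? G y b))))
    where
    kept? : ∀ y → Dec (Kept y)
    kept? y = ¬? (y ≟ v) ×-dec ¬? (y ≟ b)

  merged-sym : ∀ {y z} → Merged y z → Merged z y
  merged-sym (merged k₁ k₂ l j) = merged k₂ k₁ (≢-sym l) (joined-sym j)
    where
    joined-sym : ∀ {y z} → Joined y z → Joined z y
    joined-sym (inj₁ e)              = inj₁ (Edge-sym G e)
    joined-sym (inj₂ (inj₁ (p , e))) = inj₂ (inj₂ (p , Edge-sym G e))
    joined-sym (inj₂ (inj₂ (p , e))) = inj₂ (inj₁ (p , Edge-sym G e))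

  open FromRelation merged? merged-sym (λ m → Merged.loopless m refl) public
    renaming (graph to contracted)

  merged-avoiding-a : ∀ {y z} → Merged y z → y ≢ a → z ≢ a → Edge G y z
  merged-avoiding-a (merged _ _ _ (inj₁ e))              _   _   = e
  merged-avoiding-a (merged _ _ _ (inj₂ (inj₁ (p , _)))) y≢a _   = ⊥-elim (y≢a p)
  merged-avoiding-a (merged _ _ _ (inj₂ (inj₂ (p , _)))) _   z≢a = ⊥-elim (z≢a p)

  merged-at-a : ∀ {z} → Merged a z → Edge G a z ⊎ Edge G b z
  merged-at-a (merged _ _ _ (inj₁ e))              = inj₁ e
  merged-at-a (merged _ _ _ (inj₂ (inj₁ (_ , e)))) = inj₂ e
  merged-at-a (merged _ _ l (inj₂ (inj₂ (p , _)))) = ⊥-elim (l (sym p))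

  data Sides : Fin n → Fin n → Set where
    a-b : Sides a b
    b-a : Sides b a

  x≢x′ : ∀ {x x′} → Sides x x′ → x ≢ x′
  x≢x′ a-b = distinct
  x≢x′ b-a = ≢-sym distinct

  v-x : ∀ {x x′} → Sides x x′ → Edge G v x
  v-x a-b = edgeᵃ
  v-x b-a = edgeᵇ

  v-x′ : ∀ {x x′} → Sides x x′ → Edge G v x′
  v-x′ a-b = edgeᵇ
  v-x′ b-a = edgeᵃ

  fresh-≢x : ∀ {x x′ y} → Sides x x′ → Fresh y → x ≢ y
  fresh-≢x a-b (y≢a , _ , _) = ≢-sym y≢a
  fresh-≢x b-a (_ , y≢b , _) = ≢-sym y≢b

  fresh-≢x′ : ∀ {x x′ y} → Sides x x′ → Fresh y → x′ ≢ y
  fresh-≢x′ a-b (_ , y≢b , _) = ≢-sym y≢b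
  fresh-≢x′ b-a (y≢a , _ , _) = ≢-sym y≢a

  detour-length : ∀ x h zs x′ → length (x ∷ h ∷ zs ++ x′ ∷ v ∷ []) ≡ 2 + length (x ∷ h ∷ zs)
  detour-length x h zs x′ = cong (2 +_) (trans (length-++ zs) (ℕ.+-comm (length zs) 2))

  module _ {x x′} (S : Sides x x′) where

    direct-cycle : ∀ h zs → All Fresh (h ∷ zs) → Unique (h ∷ zs) → 3 ≤ length (x ∷ h ∷ zs) →
                   Edge G x h → Linked (Edge G) (h ∷ zs ++ [ x ]) → CycleList G
    direct-cycle h zs fresh u long xh l = record
      { vertices = x ∷ h ∷ zs
      ; unique   = All.map (fresh-≢x S) fresh ∷ u
      ; long     = long
      ; closed   = xh ∷ l
      }

    detour-cycle : ∀ h zs → All Fresh (h ∷ zs) → Unique (h ∷ zs) →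
                   Edge G x h → Linked (Edge G) (h ∷ zs ++ [ x′ ]) → CycleList G
    detour-cycle h zs fresh u xh l = record
      { vertices = x ∷ h ∷ zs ++ x′ ∷ v ∷ []
      ; unique   = All.++⁺ (All.map (fresh-≢x S) fresh) (x≢x′ S ∷ ≢-sym (Edge⇒≢ G (v-x S)) ∷ [])
                   ∷ Unique.++⁺ u ((≢-sym (Edge⇒≢ G (v-x′ S)) ∷ []) ∷ [] ∷ []) not-both
      ; long     = subst (3 ≤_) (sym (detour-length x h zs x′)) (s≤s (s≤s (s≤s z≤n)))
      ; closed   = xh ∷ subst (Linked (Edge G)) (sym (++-assoc (h ∷ zs) (x′ ∷ v ∷ []) [ x ]))
                          (linked-join (h ∷ zs) l (Edge-sym G (v-x′ S) ∷ v-x S ∷ [-]))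
      }
      where
      not-both : Disjoint (h ∷ zs) (x′ ∷ v ∷ [])
      not-both (y∈ , here refl)         = fresh-≢x′ S (All.lookup fresh y∈) refl
      not-both (y∈ , there (here refl)) = proj₂ (proj₂ (All.lookup fresh y∈)) refl

  module _ (odd : OddCycles G) where

    retarget : ∀ h zs → All (_≢ a) (h ∷ zs) → Linked Merged (h ∷ zs ++ [ a ]) →
               Linked (Edge G) (h ∷ zs ++ [ a ]) ⊎ Linked (Edge G) (h ∷ zs ++ [ b ])
    retarget h []       _                    (m ∷ [-]) =
      Sum.map (λ e → Edge-sym G e ∷ [-]) (λ e → Edge-sym G e ∷ [-]) (merged-at-a (merged-sym m))
    retarget h (z ∷ zs) (h≢a ∷ ≢a@(z≢a ∷ _)) (m ∷ l) =
      Sum.map (merged-avoiding-a m h≢a z≢a ∷_) (merged-avoiding-a m h≢a z≢a ∷_) (retarget z zs ≢a l)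

    -- The two edges at a of a contracted cycle come from a or from b; if they come from different
    -- ends, putting v and the other end back makes the cycle two longer.
    ¬even-starting-at-a : ∀ ys → Unique (a ∷ ys) → 3 ≤ length (a ∷ ys) →
                          CyclicallyLinked (Edge contracted) (a ∷ ys) → ¬ Even (length (a ∷ ys))
    ¬even-starting-at-a []       _        (s≤s ())
    ¬even-starting-at-a (h ∷ zs) (a∉ ∷ u) long closed even with Linked.map (Edge⇒R _ _) closed
    ... | m ∷ l = lift-cycle (merged-at-a m) (retarget h zs ≢a l)
      where
      ≢a : All (_≢ a) (h ∷ zs)
      ≢a = All.map ≢-sym a∉

      fresh : All Fresh (h ∷ zs)
      fresh = All.zipWith (λ (y≢a , _ , m) → y≢a , proj₂ (Merged.kept₁ m) , proj₁ (Merged.kept₁ m))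
                (≢a , linked-sources (h ∷ zs) l)

      lift-cycle : Edge G a h ⊎ Edge G b h → Linked (Edge G) (h ∷ zs ++ [ a ]) ⊎ Linked (Edge G) (h ∷ zs ++ [ b ]) → ⊥
      lift-cycle (inj₁ ah) (inj₁ l′) = odd (direct-cycle a-b h zs fresh u long ah l′) even
      lift-cycle (inj₂ bh) (inj₂ l′) = odd (direct-cycle b-a h zs fresh u long bh l′) even
      lift-cycle (inj₁ ah) (inj₂ l′) = odd (detour-cycle a-b h zs fresh u ah l′) (subst Even (sym (detour-length a h zs b)) even)
      lift-cycle (inj₂ bh) (inj₁ l′) = odd (detour-cycle b-a h zs fresh u bh l′) (subst Even (sym (detour-length b h zs a)) even)

    ¬even-avoiding-a : (C : CycleList contracted) → a ∉ vertices C → ¬ Even (length (vertices C))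
    ¬even-avoiding-a record { vertices = [] ; long = () }
    ¬even-avoiding-a record { vertices = x ∷ xs ; unique = u ; long = long ; closed = closed } a∉ = odd record
      { vertices = x ∷ xs
      ; unique   = u
      ; long     = long
      ; closed   = linked-map (λ a≢y a≢z e → merged-avoiding-a (Edge⇒R _ _ e) (≢-sym a≢y) (≢-sym a≢z))
                     (All.++⁺ ≢a (All.head ≢a ∷ [])) closed
      }
      where
      ≢a : All (a ≢_) (x ∷ xs)
      ≢a = ¬Any⇒All¬ (x ∷ xs) a∉

    ¬even-through-a-rotated : (C : CycleList contracted) → a ∈ vertices C → ¬ Even (length (vertices C))
    ¬even-through-a-rotated record { vertices = cs ; unique = u ; long = long ; closed = closed } a∈ with ∈-∃++ a∈
    ... | A , B , refl = ¬even-starting-at-a (B ++ A) (unique-swap A u) (subst (3 ≤_) length≡ long)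
                           (cyclicallyLinked-rotate A (a ∷ B) closed) ∘ subst Even length≡
      where
      length≡ : length (A ++ a ∷ B) ≡ length (a ∷ B ++ A)
      length≡ = length-++-comm A (a ∷ B)

    contracted-odd : OddCycles contracted
    contracted-odd C with a ∈? vertices C
    ... | no a∉  = ¬even-avoiding-a C a∉
    ... | yes a∈ = ¬even-through-a-rotated C a∈

  kept-edge : ∀ {y u} → Fresh y → Edge G y u → u ≢ b → Edge contracted y u
  kept-edge (y≢a , y≢b , y≢v) yu u≢b = R⇒Edge (merged (y≢v , y≢b) (neighbour≢v y≢a y≢b yu , u≢b) (Edge⇒≢ G yu) (inj₁ yu))

  redirected-edge : ∀ {y} → Fresh y → Edge G y b → Edge contracted y a
  redirected-edge (y≢a , y≢b , y≢v) yb = R⇒Edge (merged (y≢v , y≢b) (≢-sym v≢a , distinct) y≢a (inj₂ (inj₂ (refl , yb))))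

  -- Replacing the neighbour b by a keeps two neighbours apart, as a and b have no common neighbour but v.
  contracted-two-neighbours : OddCycles G → ∀ {y u₁ u₂} → Fresh y → u₁ ≢ u₂ → Edge G y u₁ → Edge G y u₂ →
                              TwoNeighbours contracted y
  contracted-two-neighbours odd {y} {u₁} {u₂} fy u₁≢u₂ e₁ e₂ with u₁ ≟ b | u₂ ≟ b
  ... | yes refl | yes refl = ⊥-elim (u₁≢u₂ refl)
  ... | yes refl | no u₂≢b  = a , u₂ , (λ { refl → ¬both e₂ e₁ }) , redirected-edge fy e₁ , kept-edge fy e₂ u₂≢b
    where
    ¬both : Edge G y a → Edge G y b → ⊥
    ¬both ya yb = ¬common-neighbour odd (Edge-sym G ya) (Edge-sym G yb) (proj₂ (proj₂ fy))
  ... | no u₁≢b  | yes refl = u₁ , a , (λ { refl → ¬both e₁ e₂ }) , kept-edge fy e₁ u₁≢b , redirected-edge fy e₂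
    where
    ¬both : Edge G y a → Edge G y b → ⊥
    ¬both ya yb = ¬common-neighbour odd (Edge-sym G ya) (Edge-sym G yb) (proj₂ (proj₂ fy))
  ... | no u₁≢b  | no u₂≢b  = u₁ , u₂ , u₁≢u₂ , kept-edge fy e₁ u₁≢b , kept-edge fy e₂ u₂≢b

  module _ (odd : OddCycles G) (noPendant : NoPendant G) (two-at-a : TwoNeighbours contracted a) where

    two-via : ∀ {y u} → Fresh y → Edge G y u → TwoNeighbours contracted y
    two-via {y} fy yu with noPendant y _ yu
    ... | u′ , u′≢u , yu′ = contracted-two-neighbours odd fy (≢-sym u′≢u) yu yu′

    merged-two-neighbours : ∀ {y z} → Merged y z → TwoNeighbours contracted y
    merged-two-neighbours {y} m with y ≟ a
    ... | yes refl = two-at-a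
    ... | no y≢a with m
    ...   | merged (y≢v , y≢b) _ _ (inj₁ yz)              = two-via (y≢a , y≢b , y≢v) yz
    ...   | merged _          _ _ (inj₂ (inj₁ (y≡a , _))) = ⊥-elim (y≢a y≡a)
    ...   | merged (y≢v , y≢b) _ _ (inj₂ (inj₂ (_ , yb)))  = two-via (y≢a , y≢b , y≢v) yb

    contracted-noPendant : NoPendant contracted
    contracted-noPendant y z yz = another-neighbour {G = contracted} (merged-two-neighbours (Edge⇒R y z yz)) z

  position : ∀ {x x′} → Sides x x′ → ∀ y → y ≡ x ⊎ y ≡ x′ ⊎ y ≡ v ⊎ Fresh y
  position {x} {x′} S y with y ≟ x | y ≟ x′ | y ≟ v
  ... | yes y≡x | _        | _       = inj₁ y≡x
  ... | no _    | yes y≡x′ | _       = inj₂ (inj₁ y≡x′)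
  ... | no _    | no _     | yes y≡v = inj₂ (inj₂ (inj₁ y≡v))
  ... | no y≢x  | no y≢x′  | no y≢v  = inj₂ (inj₂ (inj₂ (fresh S y≢x y≢x′ y≢v)))
    where
    fresh : ∀ {x x′} → Sides x x′ → y ≢ x → y ≢ x′ → y ≢ v → Fresh y
    fresh a-b y≢a y≢b y≢v = y≢a , y≢b , y≢v
    fresh b-a y≢b y≢a y≢v = y≢a , y≢b , y≢v

  -- Conjugating by the transposition of a and x makes x play the role of the merged vertex.
  ρ-x′ : ∀ {x x′} → Sides x x′ → transpose a x ⟨$⟩ʳ x′ ≡ b
  ρ-x′ a-b = transpose-fix (≢-sym distinct) (≢-sym distinct)
  ρ-x′ b-a = transpose-matchˡ a b

  ρ-b : ∀ {x x′} → Sides x x′ → transpose a x ⟨$⟩ʳ b ≡ x′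
  ρ-b a-b = transpose-fix (≢-sym distinct) (≢-sym distinct)
  ρ-b b-a = transpose-matchʳ a b

  ρ-fix : ∀ {x x′ y} → Sides x x′ → y ≢ a → y ≢ b → transpose a x ⟨$⟩ʳ y ≡ y
  ρ-fix a-b y≢a y≢b = transpose-fix y≢a y≢a
  ρ-fix b-a y≢a y≢b = transpose-fix y≢a y≢b

  ρ-v : ∀ {x x′} → Sides x x′ → transpose a x ⟨$⟩ʳ v ≡ v
  ρ-v S = ρ-fix S v≢a v≢b

  v-isolated : Isolated contracted v
  v-isolated z vz = proj₁ (Merged.kept₁ (Edge⇒R v z vz)) refl

  b-isolated : Isolated contracted b
  b-isolated z bz = proj₂ (Merged.kept₁ (Edge⇒R b z bz)) refl

  fresh-active : ∀ {y z} → Fresh y → Edge G y z → NonIsolated contracted y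
  fresh-active {z = z} fy@(y≢a , y≢b , _) yz with z ≟ b
  ... | yes refl = a , redirected-edge fy yz
  ... | no z≢b   = z , kept-edge fy yz z≢b

  neighbour-of-a : ∀ {w} → Edge contracted a w → Fresh w × (Edge G a w ⊎ Edge G b w)
  neighbour-of-a {w} aw with Edge⇒R a w aw
  ... | m@(merged _ (w≢v , w≢b) a≢w _) = (≢-sym a≢w , w≢b , w≢v) , merged-at-a m

  -- The cycle of the contracted permutation through a enters a from t and leaves to s;
  -- splicing in v and the other end of the contracted path gives a permutation of G.
  module Lift (active-a : NonIsolated contracted a) (P′ : NeighbourPermutation contracted) where
    open NeighbourPermutation P′ using () renaming (π to π′; adjacent to adjacent′; fixed to fixed′)

    s t : Fin n
    s = π′ ⟨$⟩ʳ a
    t = π′ ⟨$⟩ˡ a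

    s-fresh : Fresh s
    s-fresh = proj₁ (neighbour-of-a (adjacent′ a active-a))

    t-neighbour : Fresh t × (Edge G a t ⊎ Edge G b t)
    t-neighbour = neighbour-of-a (NeighbourPermutation.adjacent (reverse P′) a active-a)

    entry : ∃[ x ] ∃[ x′ ] Sides x x′ × Edge G x t
    entry with proj₂ t-neighbour
    ... | inj₁ at = a , b , a-b , at
    ... | inj₂ bt = b , a , b-a , bt

    exit : ∀ {x x′} → Sides x x′ → ¬ Edge G x s → Edge G x′ s
    exit S ¬xs with proj₂ (neighbour-of-a (adjacent′ a active-a)) | S
    ... | inj₁ as | a-b = ⊥-elim (¬xs as)
    ... | inj₂ bs | a-b = bs
    ... | inj₁ as | b-a = as
    ... | inj₂ bs | b-a = ⊥-elim (¬xs bs)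

    -- If s is a neighbour of x, v and x′ form a 2-cycle; otherwise the cycle runs x v x′ s.
    splice : ∀ {x x′} → Sides x x′ → Dec (Edge G x s) → Permutation′ n
    splice {x} {x′} _ (yes _) = transpose v x′
    splice {x} {x′} _ (no _)  = transpose x v ∘ₚ transpose x x′

    lifted : ∀ {x x′} → Sides x x′ → Dec (Edge G x s) → Permutation′ n
    lifted {x} S d = splice S d ∘ₚ transpose a x ∘ₚ π′ ∘ₚ transpose a x

    module _ {x x′} (S : Sides x x′) (xt : Edge G x t) where

      x≢v : x ≢ v
      x≢v = ≢-sym (Edge⇒≢ G (v-x S))

      x′≢v : x′ ≢ v
      x′≢v = ≢-sym (Edge⇒≢ G (v-x′ S))

      σ : Dec (Edge G x s) → Fin n → Fin n
      σ d y = transpose a x ⟨$⟩ʳ (splice S d ⟨$⟩ʳ y)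

      via : ∀ d y {w} → σ d y ≡ w → lifted S d ⟨$⟩ʳ y ≡ transpose a x ⟨$⟩ʳ (π′ ⟨$⟩ʳ w)
      via d y = cong (λ u → transpose a x ⟨$⟩ʳ (π′ ⟨$⟩ʳ u))

      via-a : ∀ d y → σ d y ≡ a → lifted S d ⟨$⟩ʳ y ≡ s
      via-a d y eq = trans (via d y eq) (ρ-fix S (proj₁ s-fresh) (proj₁ (proj₂ s-fresh)))

      via-b : ∀ d y → σ d y ≡ b → lifted S d ⟨$⟩ʳ y ≡ x′
      via-b d y eq = trans (via d y eq) (trans (cong (transpose a x ⟨$⟩ʳ_) (fixed′ b b-isolated)) (ρ-b S))

      via-v : ∀ d y → σ d y ≡ v → lifted S d ⟨$⟩ʳ y ≡ v
      via-v d y eq = trans (via d y eq) (trans (cong (transpose a x ⟨$⟩ʳ_) (fixed′ v v-isolated)) (ρ-v S))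

      σ-v : ∀ d → σ d v ≡ b
      σ-v (yes _) = trans (cong (transpose a x ⟨$⟩ʳ_) (transpose-matchˡ v x′)) (ρ-x′ S)
      σ-v (no _)  = trans (cong (transpose a x ⟨$⟩ʳ_)
                            (trans (cong (transpose x x′ ⟨$⟩ʳ_) (transpose-matchʳ x v)) (transpose-matchˡ x x′)))
                          (ρ-x′ S)

      σ-fresh : ∀ d {y} → Fresh y → σ d y ≡ y
      σ-fresh d {y} fy@(y≢a , y≢b , y≢v) = trans (cong (transpose a x ⟨$⟩ʳ_) (κ-fix d)) (ρ-fix S y≢a y≢b)
        where
        κ-fix : ∀ d → splice S d ⟨$⟩ʳ y ≡ y
        κ-fix (yes _) = transpose-fix y≢v (≢-sym (fresh-≢x′ S fy))
        κ-fix (no _)  = trans (cong (transpose x x′ ⟨$⟩ʳ_) (transpose-fix (≢-sym (fresh-≢x S fy)) y≢v))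
                              (transpose-fix (≢-sym (fresh-≢x S fy)) (≢-sym (fresh-≢x′ S fy)))

      adjacent-x : ∀ d → Edge G x (lifted S d ⟨$⟩ʳ x)
      adjacent-x (yes xs) = subst (Edge G x) (sym (via-a (yes xs) x σx)) xs
        where σx = trans (cong (transpose a x ⟨$⟩ʳ_) (transpose-fix x≢v (x≢x′ S))) (transpose-matchʳ a x)
      adjacent-x (no ¬xs) = subst (Edge G x) (sym (via-v (no ¬xs) x σx)) (Edge-sym G (v-x S))
        where σx = trans (cong (transpose a x ⟨$⟩ʳ_) (trans (cong (transpose x x′ ⟨$⟩ʳ_) (transpose-matchˡ x v))
                                                            (transpose-fix (≢-sym x≢v) (≢-sym x′≢v))))
                         (ρ-v S)

      adjacent-x′ : ∀ d → Edge G x′ (lifted S d ⟨$⟩ʳ x′)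
      adjacent-x′ (yes xs) = subst (Edge G x′) (sym (via-v (yes xs) x′ σx′)) (Edge-sym G (v-x′ S))
        where σx′ = trans (cong (transpose a x ⟨$⟩ʳ_) (transpose-matchʳ v x′)) (ρ-v S)
      adjacent-x′ (no ¬xs) = subst (Edge G x′) (sym (via-a (no ¬xs) x′ σx′)) (exit S ¬xs)
        where σx′ = trans (cong (transpose a x ⟨$⟩ʳ_) (trans (cong (transpose x x′ ⟨$⟩ʳ_) (transpose-fix (≢-sym (x≢x′ S)) x′≢v))
                                                             (transpose-matchʳ x x′)))
                          (transpose-matchʳ a x)

      adjacent-v : ∀ d → Edge G v (lifted S d ⟨$⟩ʳ v)
      adjacent-v d = subst (Edge G v) (sym (via-b d v (σ-v d))) (v-x′ S)

      adjacent-fresh : ∀ d {y z} → Fresh y → Edge G y z → Edge G y (lifted S d ⟨$⟩ʳ y)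
      adjacent-fresh d {y} fy@(y≢a , y≢b , _) yz =
        subst (Edge G y) (sym (via d y (σ-fresh d fy))) (leave (π′ ⟨$⟩ʳ y ≟ a))
        where
        leave : Dec (π′ ⟨$⟩ʳ y ≡ a) → Edge G y (transpose a x ⟨$⟩ʳ (π′ ⟨$⟩ʳ y))
        leave (yes πy≡a) = subst (Edge G y) (sym (trans (cong (transpose a x ⟨$⟩ʳ_) πy≡a) (transpose-matchˡ a x)))
                             (Edge-sym G (subst (Edge G x) (sym y≡t) xt))
          where
          y≡t : y ≡ t
          y≡t = trans (sym (inverseˡ π′)) (cong (π′ ⟨$⟩ˡ_) πy≡a)
        leave (no πy≢a) = subst (Edge G y) (sym (ρ-fix S πy≢a πy≢b))
                            (merged-avoiding-a (Edge⇒R y _ (adjacent′ y (fresh-active fy yz))) y≢a πy≢a)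
          where
          πy≢b : π′ ⟨$⟩ʳ y ≢ b
          πy≢b eq = y≢b (permutation-injective π′ (trans eq (sym (fixed′ b b-isolated))))

      fixed-isolated : ∀ d {y} → Isolated G y → lifted S d ⟨$⟩ʳ y ≡ y
      fixed-isolated d {y} isolated = trans (via d y (σ-fresh d fy))
                                         (trans (cong (transpose a x ⟨$⟩ʳ_) (fixed′ y isolated′)) (ρ-fix S y≢a y≢b))
        where
        y≢a : y ≢ a
        y≢a refl = isolated v (Edge-sym G edgeᵃ)
        y≢b : y ≢ b
        y≢b refl = isolated v (Edge-sym G edgeᵇ)
        fy : Fresh y
        fy = y≢a , y≢b , λ { refl → isolated a edgeᵃ }
        isolated′ : Isolated contracted y
        isolated′ w yw with Merged.joined (Edge⇒R y w yw)
        ... | inj₁ e                = isolated w e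
        ... | inj₂ (inj₁ (y≡a , _)) = y≢a y≡a
        ... | inj₂ (inj₂ (_ , yb))  = isolated b yb

    neighbourPermutation : NeighbourPermutation G
    neighbourPermutation with entry
    ... | x , x′ , S , xt = record { π = lifted S d ; adjacent = adjacent ; fixed = λ y → fixed-isolated S xt d }
      where
      d : Dec (Edge G x s)
      d = Edge? G x s
      adjacent : ∀ y → NonIsolated G y → Edge G y (lifted S d ⟨$⟩ʳ y)
      adjacent y (z , yz) with position S y
      ... | inj₁ refl               = adjacent-x S xt d
      ... | inj₂ (inj₁ refl)        = adjacent-x′ S xt d
      ... | inj₂ (inj₂ (inj₁ refl)) = adjacent-v S xt d
      ... | inj₂ (inj₂ (inj₂ fy))   = adjacent-fresh S xt d fy yz

  contraction : OddCycles G → NoPendant G → ∀ {p q} → p ≢ q → Fresh p → Fresh q →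
                Edge G a p ⊎ Edge G b p → Edge G a q ⊎ Edge G b q → Reduction G
  contraction odd noPendant {p} {q} p≢q fp fq ap⊎bp aq⊎bq = record
    { smaller        = contracted
    ; odd            = contracted-odd odd
    ; noPendant      = contracted-noPendant odd noPendant two-at-a
    ; removed        = v
    ; removed-active = a , edgeᵃ
    ; shrinks        = λ {y} {z} yz → shrinks (Edge⇒R y z yz)
    ; lift           = Lift.neighbourPermutation (p , proj₁ (proj₂ (proj₂ (proj₂ two-at-a))))
    }
    where
    at-a : ∀ {w} → Fresh w → Edge G a w ⊎ Edge G b w → Edge contracted a w
    at-a (w≢a , w≢b , w≢v) (inj₁ aw) = R⇒Edge (merged (≢-sym v≢a , distinct) (w≢v , w≢b) (≢-sym w≢a) (inj₁ aw))
    at-a (w≢a , w≢b , w≢v) (inj₂ bw) = R⇒Edge (merged (≢-sym v≢a , distinct) (w≢v , w≢b) (≢-sym w≢a) (inj₂ (inj₁ (refl , bw))))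

    two-at-a : TwoNeighbours contracted a
    two-at-a = p , q , p≢q , at-a fp ap⊎bp , at-a fq aq⊎bq

    shrinks : ∀ {y z} → Merged y z → y ≢ v × NonIsolated G y
    shrinks (merged (y≢v , _) _ _ (inj₁ yz))              = y≢v , _ , yz
    shrinks (merged (y≢v , _) _ _ (inj₂ (inj₁ (refl , _)))) = y≢v , v , Edge-sym G edgeᵃ
    shrinks (merged (y≢v , _) _ _ (inj₂ (inj₂ (_ , yb))))  = y≢v , b , yb

module TriangleDeletion {G : Graph n} {v a b} (N : OnlyNeighbours G v a b) (ab : Edge G a b) where
  open OnlyNeighboursProperties N
  open Deletion {G = G} fresh? public

  rotation : Permutation′ n
  rotation = transpose v a ∘ₚ transpose v b

  rotation-fresh : ∀ {y} → Fresh y → rotation ⟨$⟩ʳ y ≡ y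
  rotation-fresh (y≢a , y≢b , y≢v) = trans (cong (transpose v b ⟨$⟩ʳ_) (transpose-fix y≢v y≢a)) (transpose-fix y≢v y≢b)

  rotation-adjacent : ∀ {y} → ¬ Fresh y → Edge G y (rotation ⟨$⟩ʳ y)
  rotation-adjacent {y} ¬fy with v ≟ y | a ≟ y | b ≟ y
  ... | yes refl | _        | _        = subst (Edge G v) (sym (trans (cong (transpose v b ⟨$⟩ʳ_) (transpose-matchˡ v a))
                                                                    (transpose-fix (≢-sym v≢a) distinct))) edgeᵃ
  ... | no _     | yes refl | _        = subst (Edge G a) (sym (trans (cong (transpose v b ⟨$⟩ʳ_) (transpose-matchʳ v a))
                                                                    (transpose-matchˡ v b))) ab
  ... | no _     | no _     | yes refl = subst (Edge G b) (sym (trans (cong (transpose v b ⟨$⟩ʳ_) (transpose-fix (≢-sym v≢b) (≢-sym distinct)))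
                                                                    (transpose-matchʳ v b))) (Edge-sym G edgeᵇ)
  ... | no v≢y   | no a≢y   | no b≢y   = ⊥-elim (¬fy (≢-sym a≢y , ≢-sym b≢y , ≢-sym v≢y))

  triangleDeletion : OddCycles G → (∀ {y z} → Fresh y → Edge G y z → TwoNeighbours induced y) → Reduction G
  triangleDeletion odd two = record
    { smaller        = induced
    ; odd            = induced-odd odd
    ; noPendant      = induced-noPendant two
    ; removed        = v
    ; removed-active = a , edgeᵃ
    ; shrinks        = λ {y} {z} yz → let (fy , _ , e) = Edge⇒R y z yz in proj₂ (proj₂ fy) , z , e
    ; lift           = induced-lift rotation rotation-fresh rotation-adjacent
                         (λ fy yz → let (w₁ , _ , _ , e₁ , _) = two fy yz in w₁ , e₁)
    }

NeighbourBesides : Graph n → Fin n → Fin n → Fin n → Set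
NeighbourBesides G a v b = ∃[ p ] Edge G a p × p ≢ v × p ≢ b

module Reduce {G : Graph n} (odd : OddCycles G) (noPendant : NoPendant G) where

  neighbourBesides? : ∀ a v b → Dec (NeighbourBesides G a v b)
  neighbourBesides? a v b = any? λ p → Edge? G a p ×-dec ¬? (p ≟ v) ×-dec ¬? (p ≟ b)

  swap : ∀ {v a b} → OnlyNeighbours G v a b → OnlyNeighbours G v b a
  swap N = record { distinct = ≢-sym distinct ; edgeᵃ = edgeᵇ ; edgeᵇ = edgeᵃ ; only = λ u e → Sum.swap (only u e) }
    where open OnlyNeighbours N

  module _ {v a b} (N : OnlyNeighbours G v a b) where
    open OnlyNeighboursProperties N

    ¬neighbourBesides⇒edge : ¬ NeighbourBesides G a v b → Edge G a b
    ¬neighbourBesides⇒edge ¬A with noPendant a v (Edge-sym G edgeᵃ)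
    ... | w , w≢v , aw with w ≟ b
    ...   | yes refl = aw
    ...   | no w≢b   = ⊥-elim (¬A (w , aw , w≢v , w≢b))

    both-have-neighbours : NeighbourBesides G a v b → NeighbourBesides G b v a → Reduction G
    both-have-neighbours (p , ap , p≢v , p≢b) (q , bq , q≢v , q≢a) =
      Contraction.contraction N odd noPendant p≢q (≢-sym (Edge⇒≢ G ap) , p≢b , p≢v) (q≢a , ≢-sym (Edge⇒≢ G bq) , q≢v)
        (inj₁ ap) (inj₂ bq)
      where
      p≢q : p ≢ q
      p≢q refl = ¬common-neighbour odd ap bq p≢v

    neither-has-neighbours : ¬ NeighbourBesides G a v b → ¬ NeighbourBesides G b v a → Reduction G
    neither-has-neighbours ¬A ¬B = triangleDeletion odd two
      where
      open TriangleDeletion N (¬neighbourBesides⇒edge ¬A)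

      fresh-neighbour : ∀ {y u} → Fresh y → Edge G y u → Fresh u
      fresh-neighbour (y≢a , y≢b , y≢v) yu =
        (λ { refl → ¬A (_ , Edge-sym G yu , y≢v , y≢b) }) , (λ { refl → ¬B (_ , Edge-sym G yu , y≢v , y≢a) }) ,
        neighbour≢v y≢a y≢b yu

      two : ∀ {y z} → Fresh y → Edge G y z → TwoNeighbours induced y
      two {y} fy yz with noPendant y _ yz
      ... | w , w≢z , yw = induced-two-neighbours fy (≢-sym w≢z) (fresh-neighbour fy yz) (fresh-neighbour fy yw) yz yw

    module _ (¬A : ¬ NeighbourBesides G a v b) {q} (bq : Edge G b q) (q≢v : q ≢ v) (q≢a : q ≢ a) where

      q≢b : q ≢ b
      q≢b = ≢-sym (Edge⇒≢ G bq)

      fresh-at-q : ∀ {u} → Edge G q u → u ≢ b → Fresh u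
      fresh-at-q qu u≢b = (λ { refl → ¬A (q , Edge-sym G qu , q≢v , q≢b) }) , u≢b , neighbour≢v q≢a q≢b qu

      -- q is b's only neighbour besides the triangle, but keeps two neighbours when the triangle goes.
      deletion-beside : (∀ {y} → Edge G b y → y ≢ v → y ≢ a → y ≡ q) →
                        ∀ {r r′} → r ≢ r′ → Edge G q r → Edge G q r′ → r ≢ b → r′ ≢ b → Reduction G
      deletion-beside only-q r≢r′ qr qr′ r≢b r′≢b = triangleDeletion odd two
        where
        open TriangleDeletion N (¬neighbourBesides⇒edge ¬A)

        fresh-neighbour : ∀ {y u} → Fresh y → y ≢ q → Edge G y u → Fresh u
        fresh-neighbour (y≢a , y≢b , y≢v) y≢q yu =
          (λ { refl → ¬A (_ , Edge-sym G yu , y≢v , y≢b) }) , (λ { refl → y≢q (only-q (Edge-sym G yu) y≢v y≢a) }) ,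
          neighbour≢v y≢a y≢b yu

        two : ∀ {y z} → Fresh y → Edge G y z → TwoNeighbours induced y
        two {y} fy yz with y ≟ q
        ... | yes refl = induced-two-neighbours fy r≢r′ (fresh-at-q qr r≢b) (fresh-at-q qr′ r′≢b) qr qr′
        ... | no y≢q with noPendant y _ yz
        ...   | w , w≢z , yw = induced-two-neighbours fy (≢-sym w≢z)
                                 (fresh-neighbour fy y≢q yz) (fresh-neighbour fy y≢q yw) yz yw

      -- q has degree two and its neighbour b has the two neighbours v and a besides q.
      contraction-at-q : ∀ {r} → OnlyNeighbours G q b r → Reduction G
      contraction-at-q N′ with fresh-at-q (OnlyNeighbours.edgeᵇ N′) (≢-sym (OnlyNeighbours.distinct N′))
      ... | r≢a , _ , r≢v = Contraction.contraction N′ odd noPendant v≢a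
                              (v≢b , ≢-sym r≢v , ≢-sym q≢v) (distinct , ≢-sym r≢a , ≢-sym q≢a)
                              (inj₁ (Edge-sym G edgeᵇ)) (inj₁ (Edge-sym G (¬neighbourBesides⇒edge ¬A)))

      lopsided : Reduction G
      lopsided with any? (λ q′ → Edge? G b q′ ×-dec ¬? (q′ ≟ v) ×-dec ¬? (q′ ≟ a) ×-dec ¬? (q′ ≟ q))
      ... | yes (q′ , bq′ , q′≢v , q′≢a , q′≢q) = Contraction.contraction N odd noPendant (≢-sym q′≢q)
                                                   (q≢a , q≢b , q≢v) (q′≢a , ≢-sym (Edge⇒≢ G bq′) , q′≢v) (inj₂ bq) (inj₂ bq′)
      ... | no ¬q′ with noPendant q b (Edge-sym G bq)
      ...   | r , r≢b , qr with any? (λ r′ → Edge? G q r′ ×-dec ¬? (r′ ≟ b) ×-dec ¬? (r′ ≟ r))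
      ...     | yes (r′ , qr′ , r′≢b , r′≢r) = deletion-beside only-q (≢-sym r′≢r) qr qr′ r≢b r′≢b
        where
        only-q : ∀ {y} → Edge G b y → y ≢ v → y ≢ a → y ≡ q
        only-q {y} by y≢v y≢a with y ≟ q
        ... | yes y≡q = y≡q
        ... | no y≢q  = ⊥-elim (¬q′ (y , by , y≢v , y≢a , y≢q))
      ...     | no ¬r′ = contraction-at-q
                           record { distinct = ≢-sym r≢b ; edgeᵃ = Edge-sym G bq ; edgeᵇ = qr ; only = only-b-r }
        where
        only-b-r : ∀ u → Edge G q u → u ≡ b ⊎ u ≡ r
        only-b-r u qu with u ≟ b | u ≟ r
        ... | yes u≡b | _       = inj₁ u≡b
        ... | no _    | yes u≡r = inj₂ u≡r
        ... | no u≢b  | no u≢r  = ⊥-elim (¬r′ (u , qu , u≢b , u≢r))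

  reduce : ∀ {y z} → Edge G y z → Reduction G
  reduce e with onlyNeighbours odd noPendant e
  ... | v , a , b , N with neighbourBesides? a v b | neighbourBesides? b v a
  ...   | yes A | yes B = both-have-neighbours N A B
  ...   | no ¬A | no ¬B = neither-has-neighbours N ¬A ¬B
  ...   | no ¬A | yes (q , bq , q≢v , q≢a) = lopsided N ¬A bq q≢v q≢a
  ...   | yes (p , ap , p≢v , p≢b) | no ¬B = lopsided (swap N) ¬B ap p≢v p≢b

-- The induction

-- L lists (at least) the non-isolated vertices; each reduction isolates one more vertex.
oddCycles⇒neighbourPermutation : ∀ fuel (G : Graph n) (L : List (Fin n)) → length L ≤ fuel → (∀ {y z} → Edge G y z → y ∈ L) →
                       OddCycles G → NoPendant G → NeighbourPermutation G
oddCycles⇒neighbourPermutation {n} fuel G L bound covers odd noPendant with any? (nonIsolated? {G = G})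
... | no none = identityPermutation (λ y z e → none (y , z , e))
... | yes (y , z , e) with fuel
...   | zero  = ⊥-elim (ℕ.<⇒≱ (nonempty (covers e)) bound)
  where
  nonempty : ∀ {xs} → y ∈ xs → 0 < length xs
  nonempty (here _)  = s≤s z≤n
  nonempty (there _) = s≤s z≤n
...   | suc f = lift (oddCycles⇒neighbourPermutation f smaller L′ bound′ covers′ odd′ noPendant′)
  where
  open Reduction (Reduce.reduce odd noPendant e) renaming (odd to odd′; noPendant to noPendant′)

  L′ : List (Fin n)
  L′ = filter (λ w → ¬? (w ≟ removed)) L

  bound′ : length L′ ≤ f
  bound′ = ℕ.≤-pred (ℕ.≤-trans (filter-notAll (λ w → ¬? (w ≟ removed)) L
             (Any.map (λ removed≡w w≢removed → w≢removed (sym removed≡w)) (covers (proj₂ removed-active)))) bound)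

  covers′ : ∀ {y z} → Edge smaller y z → y ∈ L′
  covers′ e′ with shrinks e′
  ... | y≢removed , _ , e = ∈-filter⁺ (λ w → ¬? (w ≟ removed)) (covers e) y≢removed

indicator : ∀ {m} → (Fin m → Bool) → Fin m → ℕ
indicator f u = if f u then 1 else 0

sumℕ-indicator≥1 : ∀ {m} (f : Fin m → Bool) → 1 ≤ sumℕ (indicator f) → ∃[ i ] f i ≡ true
sumℕ-indicator≥1 {suc m} f le with f zero in eq
... | true  = zero , eq
... | false = let (i , fi) = sumℕ-indicator≥1 (λ u → f (suc u)) le in suc i , fi

sumℕ-indicator≥2 : ∀ {m} (f : Fin m → Bool) → 2 ≤ sumℕ (indicator f) → ∃[ i ] ∃[ j ] i ≢ j × f i ≡ true × f j ≡ true
sumℕ-indicator≥2 {suc m} f le with f zero in eq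
... | true  = let (j , fj) = sumℕ-indicator≥1 (λ u → f (suc u)) (ℕ.≤-pred le) in zero , suc j , (λ ()) , eq , fj
... | false = let (i , j , i≢j , fi , fj) = sumℕ-indicator≥2 (λ u → f (suc u)) le in
              suc i , suc j , (λ e → i≢j (Data.Fin.Properties.suc-injective e)) , fi , fj

corollary4 : ∀ {n : ℕ} (G : Graph n) → MinDegree≥ G 2 → ¬ HasEvenCycle G →
    OneSumFlow G UnitInterval
corollary4 {n} G δ≥2 ¬even = neighbourPermutation⇒flow active
  (oddCycles⇒neighbourPermutation n G (allFin n) (ℕ.≤-reflexive (length-tabulate (λ i → i))) (λ {y} _ → ∈-allFin y)
    (¬HasEvenCycle⇒OddCycles ¬even) (λ y z _ → another-neighbour {G = G} (two y) z))
  where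
  two : ∀ y → TwoNeighbours G y
  two y = sumℕ-indicator≥2 (adj G y) (δ≥2 y)

  active : ∀ y → NonIsolated G y
  active y = let (w , _ , _ , e , _) = two y in w , e
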